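{- Let $N' = (V', E')$ be an irredundant mapped network with primary input set $I$, gate set $G$, primary output set $O$ and buffer set $B$ (so $V' = I \cup O \cup G \cup B$, disjointly). Then \[ B = \bigcup_{g \in G} \textsc{FOT}(g) \;\cup\; \bigcup_{i \in I} \textsc{FOT}(i). \]
   Context: A (logic) network is a finite directed acyclic graph $(V,E)$ with $V = I \cup O \cup G$ a disjoint union of primary inputs $I$ (nodes of in-degree $0$, unbounded out-degree), primary outputs $O$ (nodes of in-degree $1$ and out-degree $0$), and gates $G$ (each gate has unbounded out-degree and a fixed in-degree depending on its type). A mapped network is a directed acyclic graph $(V',E')$ whose node set $V' = I \cup O \cup G \cup B$ extends such a node set by a set $B$ of buffers, where each buffer is a node of in-degree exactly $1$ (and arbitrary out-degree); primary inputs, primary outputs and gates keep the degree constraints above. In a mapped network, for a gate or primary input $n$, the fanouts $\textsc{FO}(n)$ are the gates and primary outputs $n_o$ such that there is a directed path from $n$ to $n_o$ all of whose intermediate nodes are buffers; the fanout tree $\textsc{FOT}(n)$ is the set of buffers lying on some such directed path from $n$ to some $n_o \in \textsc{FO}(n)$. Fix a positive integer $s_b$ (the splitting capacity of buffers). A mapped network is irredundant if (1) every buffer has at least one outgoing edge, and (2) there do not exist two distinct buffers whose incoming edges come from the same node and which both have out-degree smaller than $s_b$. -}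

module Defs where

open import Data.Nat using (ℕ; _<_; _≤_)
open import Data.Fin using (Fin)
open import Data.Fin.Properties using (_≟_)
open import Data.List using (List; length; filter)
open import Data.List.Membership.Propositional using (_∈_)
open import Data.Product using (_×_; _,_; proj₁; proj₂; Σ; ∃)
open import Relation.Nullary using (¬_)
open import Relation.Binary.PropositionalEquality using (_≡_; _≢_)

-- Node kinds of a mapped network.  A gate carries its type's fixed in-degree.
data Kind : Set where
  input  : Kind
  output : Kind
  gate   : ℕ → Kind
  buffer : Kind

IsInput IsOutput IsGate IsBuffer : Kind → Set
IsInput k = k ≡ input
IsOutput k = k ≡ output
IsGate k = ∃ λ a → k ≡ gate a
IsBuffer k = k ≡ buffer

record MappedNetwork : Set where
  field
    n     : ℕ
    kind  : Fin n → Kind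
    edges : List (Fin n × Fin n)

  Edge : Fin n → Fin n → Set
  Edge u v = (u , v) ∈ edges

  indeg : Fin n → ℕ
  indeg v = length (filter (λ e → proj₂ e ≟ v) edges)

  outdeg : Fin n → ℕ
  outdeg u = length (filter (λ e → proj₁ e ≟ u) edges)

  data Path : Fin n → Fin n → Set where
    edge : ∀ {u v} → Edge u v → Path u v
    step : ∀ {u w v} → Edge u w → Path w v → Path u v

  data BufPath : Fin n → Fin n → Set where
    edge : ∀ {u v} → Edge u v → BufPath u v
    step : ∀ {u w v} → Edge u w → IsBuffer (kind w) → BufPath w v → BufPath u v

  FO : Fin n → Fin n → Set
  FO x y = (IsGate (kind y) × BufPath x y) ⊎' (IsOutput (kind y) × BufPath x y)
    where
      open import Data.Sum using () renaming (_⊎_ to _⊎'_)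

  FOT : Fin n → Fin n → Set
  FOT x b = IsBuffer (kind b) × Σ (Fin n) λ y → FO x y × BufPath x b × BufPath b y

record WellFormed (N : MappedNetwork) : Set where
  open MappedNetwork N
  field
    acyclic   : ∀ v → ¬ Path v v
    inputDeg  : ∀ v → IsInput (kind v) → indeg v ≡ 0
    outputIn  : ∀ v → IsOutput (kind v) → indeg v ≡ 1
    outputOut : ∀ v → IsOutput (kind v) → outdeg v ≡ 0
    gateDeg   : ∀ v a → kind v ≡ gate a → indeg v ≡ a
    bufferDeg : ∀ v → IsBuffer (kind v) → indeg v ≡ 1

record Irredundant (sb : ℕ) (N : MappedNetwork) : Set where
  open MappedNetwork N
  field
    bufferUsed : ∀ b → IsBuffer (kind b) → ¬ (outdeg b ≡ 0)
    noTwoSmall : ∀ b₁ b₂ u → IsBuffer (kind b₁) → IsBuffer (kind b₂) → b₁ ≢ b₂ →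
                 Edge u b₁ → Edge u b₂ → ¬ (outdeg b₁ < sb × outdeg b₂ < sb)

-- A buffer b has in-degree one, and its unique predecessor cannot be a primary output (outputs have
-- no outgoing edges); walking backwards through buffers must stop, by acyclicity, at a gate or
-- primary input r. Dually, irredundancy gives b an outgoing edge whose target is not a primary
-- input (inputs have no incoming edges); walking forwards through buffers stops at a gate or primary
-- output y. The concatenated buffer-only path r → b → y exhibits b ∈ FOT(r).
module Submission where

open import Level using (Level; _⊔_; 0ℓ)
open import Defs
open import Data.Nat using (ℕ; _≤_; _<_; suc; s≤s)
open import Data.Nat.Properties using (≤-refl; ≤-pred; <-≤-trans)
open import Data.Fin using (Fin)
open import Data.Fin.Properties using (_≟_)
open import Data.Product using (_×_; Σ; ∃-syntax; _,_; proj₁; proj₂)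
open import Data.Sum using (_⊎_; inj₁; inj₂)
open import Data.Empty using (⊥-elim)
open import Data.List using (List; []; _∷_; length; filter; allFin)
open import Data.List.Properties using (filter-notAll; length-tabulate)
open import Data.List.Membership.Propositional using (_∈_)
open import Data.List.Membership.Propositional.Properties using (∈-filter⁺; ∈-filter⁻; ∈-allFin)
open import Data.List.Relation.Unary.Any using (here)
import Data.List.Relation.Unary.Any as Any
open import Function using (flip)
open import Induction.WellFounded using (WellFounded; Acc; acc)
open import Relation.Binary.Core using (Rel)
open import Relation.Binary.Construct.Closure.Transitive using (TransClosure; [_]; _∷_; _∷ʳ_)
open import Relation.Nullary using (¬_; ¬?)
open import Relation.Unary using (Pred; Decidable)
open import Relation.Binary.PropositionalEquality using (_≡_; refl; sym; subst)
open MappedNetwork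

private
  variable
    a ℓ p q : Level
    A : Set a

length≢0⇒∃∈ : (xs : List A) → ¬ length xs ≡ 0 → ∃[ x ] x ∈ xs
length≢0⇒∃∈ []       len≢0 = ⊥-elim (len≢0 refl)
length≢0⇒∃∈ (x ∷ xs) _     = x , here refl

∈⇒length≢0 : {x : A} {xs : List A} → x ∈ xs → ¬ length xs ≡ 0
∈⇒length≢0 {xs = _ ∷ _} _ ()

module _ {P : Pred A p} (P? : Decidable P) where

  ∈-filter⇒length≢0 : {x : A} {xs : List A} → x ∈ xs → P x → ¬ length (filter P? xs) ≡ 0
  ∈-filter⇒length≢0 x∈xs px = ∈⇒length≢0 (∈-filter⁺ P? x∈xs px)

  length-filter≢0⇒∃ : (xs : List A) → ¬ length (filter P? xs) ≡ 0 → ∃[ x ] x ∈ xs × P x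
  length-filter≢0⇒∃ xs len≢0 with length≢0⇒∃∈ (filter P? xs) len≢0
  ... | x , x∈filter = x , ∈-filter⁻ P? x∈filter

∃-distrib-⊎ : {P : Pred A p} {Q : Pred A q} {R : Pred A ℓ} →
              ∃[ x ] (P x ⊎ Q x) × R x → (∃[ x ] P x × R x) ⊎ (∃[ x ] Q x × R x)
∃-distrib-⊎ (x , inj₁ px , rx) = inj₁ (x , px , rx)
∃-distrib-⊎ (x , inj₂ qx , rx) = inj₂ (x , qx , rx)

module _ {_⟶_ : Rel A ℓ} where

  reverse⁺ : ∀ {x y} → TransClosure (flip _⟶_) x y → TransClosure _⟶_ y x
  reverse⁺ [ y⟶x ]       = [ y⟶x ]
  reverse⁺ (y⟶x ∷ z⟶⁺y) = reverse⁺ z⟶⁺y ∷ʳ y⟶x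

Acyclic : {A : Set a} → Rel A ℓ → Set (a ⊔ ℓ)
Acyclic _⟶_ = ∀ v → ¬ TransClosure _⟶_ v v

Acyclic-flip : {_⟶_ : Rel A ℓ} → Acyclic _⟶_ → Acyclic (flip _⟶_)
Acyclic-flip acyclic v v⟵⁺v = acyclic v (reverse⁺ v⟵⁺v)

module _ {n : ℕ} {_⟶_ : Rel (Fin n) ℓ} (acyclic : Acyclic _⟶_) where

  private
    remove : Fin n → List (Fin n) → List (Fin n)
    remove y = filter (λ z → ¬? (z ≟ y))

  -- S is a list covering everything reachable from x; each step removes the new node from it,
  -- which is legitimate since by acyclicity that node cannot reach itself.
  acyclic⇒accessible : ∀ {k} (S : List (Fin n)) → length S < k →
                       ∀ {x} → (∀ {y} → TransClosure _⟶_ x y → y ∈ S) → Acc (flip _⟶_) x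
  acyclic⇒accessible {suc k} S |S|<k covers = acc λ {y} x⟶y →
    let y∈S = covers [ x⟶y ] in
    acyclic⇒accessible (remove y S)
      (<-≤-trans (filter-notAll _ S (Any.map (λ y≡z z≢y → z≢y (sym y≡z)) y∈S)) (≤-pred |S|<k))
      (λ {z} y⟶⁺z → ∈-filter⁺ _ (covers (x⟶y ∷ y⟶⁺z))
                                   (λ z≡y → acyclic y (subst (TransClosure _⟶_ y) z≡y y⟶⁺z)))

  acyclic⇒wellFounded : WellFounded (flip _⟶_)
  acyclic⇒wellFounded x =
    acyclic⇒accessible (allFin n) (s≤s (subst (_≤ n) (sym (length-tabulate (λ i → i))) ≤-refl))
                       (λ {y} _ → ∈-allFin y)

data Via {A : Set a} (_⟶_ : Rel A ℓ) (P : Pred A p) : Rel A (a ⊔ ℓ ⊔ p) where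
  [_]   : ∀ {x y} → x ⟶ y → Via _⟶_ P x y
  _∷⟨_⟩_ : ∀ {x y z} → x ⟶ y → P y → Via _⟶_ P y z → Via _⟶_ P x z

module _ {_⟶_ : Rel A ℓ} {P : Pred A p} where

  _++⟨_⟩_ : ∀ {x y z} → Via _⟶_ P x y → P y → Via _⟶_ P y z → Via _⟶_ P x z
  [ x⟶y ]            ++⟨ py ⟩ rest = x⟶y ∷⟨ py ⟩ rest
  (x⟶w ∷⟨ pw ⟩ path) ++⟨ py ⟩ rest = x⟶w ∷⟨ pw ⟩ (path ++⟨ py ⟩ rest)

  reverseVia : ∀ {x y} → Via (flip _⟶_) P x y → Via _⟶_ P y x
  reverseVia [ y⟶x ]            = [ y⟶x ]
  reverseVia (w⟶x ∷⟨ pw ⟩ path) = reverseVia path ++⟨ pw ⟩ [ w⟶x ]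

  escape : {D : Pred A q} → WellFounded (flip _⟶_) →
           (∀ {x} → P x → ∃[ y ] x ⟶ y × (D y ⊎ P y)) →
           ∀ {x} → P x → ∃[ y ] D y × Via _⟶_ P x y
  escape {D = D} wf next {x} px = go (wf x) px
    where
      go : ∀ {x} → Acc (flip _⟶_) x → P x → ∃[ y ] D y × Via _⟶_ P x y
      go (acc rec) px with next px
      ... | y , x⟶y , inj₁ dy = y , dy , [ x⟶y ]
      ... | y , x⟶y , inj₂ py with go (rec x⟶y) py
      ...   | z , dz , y⇝z = z , dz , x⟶y ∷⟨ py ⟩ y⇝z

nonOutput : (k : Kind) → ¬ IsOutput k → (IsGate k ⊎ IsInput k) ⊎ IsBuffer k
nonOutput input    _ = inj₁ (inj₂ refl)
nonOutput output   ¬o = ⊥-elim (¬o refl)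
nonOutput (gate a) _ = inj₁ (inj₁ (a , refl))
nonOutput buffer   _ = inj₂ refl

nonInput : (k : Kind) → ¬ IsInput k → (IsGate k ⊎ IsOutput k) ⊎ IsBuffer k
nonInput input    ¬i = ⊥-elim (¬i refl)
nonInput output   _ = inj₁ (inj₂ refl)
nonInput (gate a) _ = inj₁ (inj₁ (a , refl))
nonInput buffer   _ = inj₂ refl

≡1⇒≢0 : {m : ℕ} → m ≡ 1 → ¬ m ≡ 0
≡1⇒≢0 refl ()

module _ (N : MappedNetwork) where

  Buffer : Pred (Fin (n N)) 0ℓ
  Buffer v = IsBuffer (kind N v)

  edge⇒outdeg≢0 : ∀ {u v} → Edge N u v → ¬ outdeg N u ≡ 0
  edge⇒outdeg≢0 {u} uv = ∈-filter⇒length≢0 (λ e → proj₁ e ≟ u) uv refl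

  edge⇒indeg≢0 : ∀ {u v} → Edge N u v → ¬ indeg N v ≡ 0
  edge⇒indeg≢0 {v = v} uv = ∈-filter⇒length≢0 (λ e → proj₂ e ≟ v) uv refl

  outdeg≢0⇒edge : ∀ u → ¬ outdeg N u ≡ 0 → ∃[ v ] Edge N u v
  outdeg≢0⇒edge u outdeg≢0 with length-filter≢0⇒∃ (λ e → proj₁ e ≟ u) (edges N) outdeg≢0
  ... | (_ , v) , uv , refl = v , uv

  indeg≢0⇒edge : ∀ v → ¬ indeg N v ≡ 0 → ∃[ u ] Edge N u v
  indeg≢0⇒edge v indeg≢0 with length-filter≢0⇒∃ (λ e → proj₂ e ≟ v) (edges N) indeg≢0
  ... | (u , _) , uv , refl = u , uv

  toPath : ∀ {u v} → TransClosure (Edge N) u v → Path N u v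
  toPath [ uv ]      = edge uv
  toPath (uw ∷ path) = step uw (toPath path)

  toBufPath : ∀ {u v} → Via (Edge N) Buffer u v → BufPath N u v
  toBufPath [ uv ]            = edge uv
  toBufPath (uw ∷⟨ bw ⟩ path) = step uw bw (toBufPath path)

  bufPath⇒FO : ∀ {x y} → IsGate (kind N y) ⊎ IsOutput (kind N y) → BufPath N x y → FO N x y
  bufPath⇒FO (inj₁ gy) path = inj₁ (gy , path)
  bufPath⇒FO (inj₂ oy) path = inj₂ (oy , path)

  module _ (wf : WellFormed N) where
    open WellFormed wf

    edgeAcyclic : Acyclic (Edge N)
    edgeAcyclic v cycle = acyclic v (toPath cycle)

    bufferPredecessor : ∀ {b} → Buffer b →
                        ∃[ w ] Edge N w b × ((IsGate (kind N w) ⊎ IsInput (kind N w)) ⊎ Buffer w)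
    bufferPredecessor {b} bb with indeg≢0⇒edge b (≡1⇒≢0 (bufferDeg b bb))
    ... | w , wb = w , wb , nonOutput (kind N w) (λ ow → edge⇒outdeg≢0 wb (outputOut w ow))

    bufferSuccessor : (∀ b → Buffer b → ¬ outdeg N b ≡ 0) → ∀ {b} → Buffer b →
                      ∃[ w ] Edge N b w × ((IsGate (kind N w) ⊎ IsOutput (kind N w)) ⊎ Buffer w)
    bufferSuccessor used {b} bb with outdeg≢0⇒edge b (used b bb)
    ... | w , bw = w , bw , nonInput (kind N w) (λ iw → edge⇒indeg≢0 bw (inputDeg w iw))

    buffer∈fanoutTree : (∀ b → Buffer b → ¬ outdeg N b ≡ 0) → ∀ {b} → Buffer b →
                        ∃[ r ] (IsGate (kind N r) ⊎ IsInput (kind N r)) × FOT N r b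
    buffer∈fanoutTree used bb
      with escape {_⟶_ = flip (Edge N)} (acyclic⇒wellFounded (Acyclic-flip edgeAcyclic))
                  bufferPredecessor bb
         | escape {_⟶_ = Edge N} (acyclic⇒wellFounded edgeAcyclic) (bufferSuccessor used) bb
    ... | r , source , b⇜r | y , sink , b⇝y =
      r , source , bb , y , bufPath⇒FO sink r⇝y , toBufPath (reverseVia b⇜r) , toBufPath b⇝y
      where r⇝y = toBufPath (reverseVia b⇜r ++⟨ bb ⟩ b⇝y)

lemma1 : (sb : ℕ) → 1 ≤ sb → (N : MappedNetwork) → WellFormed N → Irredundant sb N →
         (b : Fin (n N)) →
         (IsBuffer (kind N b) →
            (Σ (Fin (n N)) λ g → IsGate (kind N g) × FOT N g b)
            ⊎ (Σ (Fin (n N)) λ i → IsInput (kind N i) × FOT N i b))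
         × ((Σ (Fin (n N)) λ g → IsGate (kind N g) × FOT N g b)
            ⊎ (Σ (Fin (n N)) λ i → IsInput (kind N i) × FOT N i b)
            → IsBuffer (kind N b))
-- Only condition (1) of irredundancy is used.
lemma1 _ _ N wf irredundant _ =
  (λ bb → ∃-distrib-⊎ (buffer∈fanoutTree N wf (Irredundant.bufferUsed irredundant) bb)) ,
  λ where (inj₁ (_ , _ , b∈FOT)) → proj₁ b∈FOT
          (inj₂ (_ , _ , b∈FOT)) → proj₁ b∈FOT
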